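{- Let $\ell\ge2$ be an integer. For all integers $0\le n<F_\ell$ we have $s_Z(n+F_{\ell+1})=s_Z(n+F_{\ell+2})$, and moreover $s_Z(F_\ell+F_{\ell+1})\bmod 2\ \neq\ s_Z(F_\ell+F_{\ell+2})\bmod 2$.
   Context: Fibonacci numbers: $F_0=0$, $F_1=1$, $F_{n+2}=F_{n+1}+F_n$. Every integer $n\ge 0$ has a unique Zeckendorf representation $n=\sum_{i\ge0}\varepsilon_i(n)F_{i+2}$ with $\varepsilon_i(n)\in\{0,1\}$ and $\varepsilon_i(n)\varepsilon_{i+1}(n)=0$ for all $i$; $s_Z(n)=\sum_{i\ge0}\varepsilon_i(n)$. -}

module Defs where

open import Data.Nat using (ℕ; zero; suc; _+_; _*_)
open import Data.List using (List; []; _∷_)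
open import Data.Empty using (⊥)
open import Data.Unit using (⊤)
open import Data.Product using (_×_)
open import Relation.Binary.PropositionalEquality using (_≡_)

F : ℕ → ℕ
F zero = 0
F (suc zero) = 1
F (suc (suc n)) = F (suc n) + F n

data Bit : Set where
  b0 b1 : Bit

bitVal : Bit → ℕ
bitVal b0 = 0
bitVal b1 = 1

-- Value of a digit list ε₀ ε₁ ε₂ … (least significant first), with offset k:
-- zval k (ε₀ ∷ ε₁ ∷ …) = Σ_i ε_i F (i + k + 2)
zval : ℕ → List Bit → ℕ
zval k [] = 0
zval k (e ∷ es) = bitVal e * F (suc (suc k)) + zval (suc k) es

NoAdj : List Bit → Set
NoAdj [] = ⊤
NoAdj (b0 ∷ es) = NoAdj es
NoAdj (b1 ∷ []) = ⊤
NoAdj (b1 ∷ b0 ∷ es) = NoAdj (b0 ∷ es)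
NoAdj (b1 ∷ b1 ∷ es) = ⊥

-- ds is a Zeckendorf representation of n:  n = Σ ε_i F_{i+2}, ε_i ε_{i+1} = 0
-- (trailing zeros allowed; they do not affect the digit sum)
IsZeck : ℕ → List Bit → Set
IsZeck n ds = (zval 0 ds ≡ n) × NoAdj ds

digitSum : List Bit → ℕ
digitSum [] = 0
digitSum (e ∷ es) = bitVal e + digitSum es

-- Zeckendorf representations are unique: a string without adjacent ones and
-- top digit at position i has value in [F (i + 2), F (i + 3)), so the top digit
-- is determined by the value. If n < F ℓ, its representation lives on the
-- positions of F 2, …, F (ℓ − 1); appending 0 1 resp. 0 0 1 above it yields the
-- representations of n + F (ℓ + 1) and n + F (ℓ + 2), both adding exactly one
-- digit. Finally F ℓ + F (ℓ + 1) = F (ℓ + 2) has digit sum 1, whereas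
-- F ℓ + F (ℓ + 2) is already a representation, with digit sum 2.
module Submission where

open import Defs
open import Data.Nat using (ℕ; zero; suc; _+_; _*_; _∸_; _<_; _≤_; _%_; z≤n; s≤s; _≤′_; ≤′-refl; ≤′-step; _<?_)
open import Data.Nat.Properties
open import Data.List using (List; []; _∷_; _++_; _∷ʳ_; length; replicate)
open import Data.List.Properties using (length-++)
open import Data.List.Reverse using (Reverse; []; _∶_∶ʳ_; reverseView)
open import Data.Product using (_×_; _,_; proj₂; ∃-syntax)
open import Data.Unit using (tt)
open import Data.Empty using (⊥-elim)
open import Relation.Nullary using (yes; no)
open import Function using (_∘_)
open import Relation.Binary using (tri<; tri≈; tri>)
open import Relation.Binary.PropositionalEquality
  using (_≡_; _≢_; refl; sym; trans; cong; cong₂; subst; subst₂; module ≡-Reasoning)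

F-step : ∀ n → F n ≤ F (suc n)
F-step zero = z≤n
F-step (suc n) = m≤m+n (F (suc n)) (F n)

F-monotone : ∀ {m n} → m ≤ n → F m ≤ F n
F-monotone m≤n = go (≤⇒≤′ m≤n)
  where
  go : ∀ {m n} → m ≤′ n → F m ≤ F n
  go ≤′-refl = ≤-refl
  go (≤′-step {n} m≤′n) = ≤-trans (go m≤′n) (F-step n)

F-pos : ∀ n → 0 < F (suc n)
F-pos zero = s≤s z≤n
F-pos (suc n) = ≤-trans (F-pos n) (F-step (suc n))

zval-++ : ∀ k xs ys → zval k (xs ++ ys) ≡ zval k xs + zval (k + length xs) ys
zval-++ k [] ys = cong (λ i → zval i ys) (sym (+-identityʳ k))
zval-++ k (x ∷ xs) ys rewrite zval-++ (suc k) xs ys | +-suc k (length xs) =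
  sym (+-assoc (bitVal x * F (2 + k)) (zval (suc k) xs) _)

zval-∷ʳ : ∀ k xs x → zval k (xs ∷ʳ x) ≡ zval k xs + bitVal x * F (2 + (k + length xs))
zval-∷ʳ k xs x = trans (zval-++ k xs (x ∷ [])) (cong (zval k xs +_) (+-identityʳ _))

zval-b1 : ∀ k → zval k (b1 ∷ []) ≡ F (2 + k)
zval-b1 k = trans (+-identityʳ _) (*-identityˡ _)

zval-replicate-b0-++ : ∀ k m ys → zval k (replicate m b0 ++ ys) ≡ zval (k + m) ys
zval-replicate-b0-++ k zero ys = cong (λ i → zval i ys) (sym (+-identityʳ k))
zval-replicate-b0-++ k (suc m) ys =
  trans (zval-replicate-b0-++ (suc k) m ys) (cong (λ i → zval i ys) (sym (+-suc k m)))

digitSum-++ : ∀ xs ys → digitSum (xs ++ ys) ≡ digitSum xs + digitSum ys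
digitSum-++ [] ys = refl
digitSum-++ (x ∷ xs) ys = trans (cong (bitVal x +_) (digitSum-++ xs ys)) (sym (+-assoc (bitVal x) _ _))

digitSum-∷ʳ : ∀ xs x → digitSum (xs ∷ʳ x) ≡ digitSum xs + bitVal x
digitSum-∷ʳ xs x = trans (digitSum-++ xs (x ∷ [])) (cong (digitSum xs +_) (+-identityʳ _))

digitSum-replicate-b0-++ : ∀ m ys → digitSum (replicate m b0 ++ ys) ≡ digitSum ys
digitSum-replicate-b0-++ zero ys = refl
digitSum-replicate-b0-++ (suc m) ys = digitSum-replicate-b0-++ m ys

NoAdj-++⁻ˡ : ∀ xs ys → NoAdj (xs ++ ys) → NoAdj xs
NoAdj-++⁻ˡ [] ys p = tt
NoAdj-++⁻ˡ (b0 ∷ xs) ys p = NoAdj-++⁻ˡ xs ys p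
NoAdj-++⁻ˡ (b1 ∷ []) ys p = tt
NoAdj-++⁻ˡ (b1 ∷ b0 ∷ xs) ys p = NoAdj-++⁻ˡ (b0 ∷ xs) ys p

NoAdj-++-b0 : ∀ xs ys → NoAdj xs → NoAdj ys → NoAdj (xs ++ b0 ∷ ys)
NoAdj-++-b0 [] ys p q = q
NoAdj-++-b0 (b0 ∷ xs) ys p q = NoAdj-++-b0 xs ys p q
NoAdj-++-b0 (b1 ∷ []) ys p q = q
NoAdj-++-b0 (b1 ∷ b0 ∷ xs) ys p q = NoAdj-++-b0 (b0 ∷ xs) ys p q

NoAdj-replicate-b0-++ : ∀ m ys → NoAdj ys → NoAdj (replicate m b0 ++ ys)
NoAdj-replicate-b0-++ zero ys p = p
NoAdj-replicate-b0-++ (suc m) ys p = NoAdj-replicate-b0-++ m ys p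

-- The F (1 + k) slack is what makes the induction go through a block 1 0.
zval-bound : ∀ k ds → NoAdj ds → zval k ds + F (1 + k) ≤ F (2 + (k + length ds))
zval-bound k [] p = F-monotone (s≤s (≤-trans (m≤m+n k 0) (n≤1+n _)))
zval-bound k (b0 ∷ es) p = begin
  zval (1 + k) es + F (1 + k)    ≤⟨ +-monoʳ-≤ _ (F-step (1 + k)) ⟩
  zval (1 + k) es + F (2 + k)    ≤⟨ zval-bound (1 + k) es p ⟩
  F (2 + (1 + k + length es))    ≡⟨ cong (λ i → F (2 + i)) (sym (+-suc k (length es))) ⟩
  F (2 + (k + length (b0 ∷ es))) ∎
  where open ≤-Reasoning
zval-bound k (b1 ∷ []) p = ≤-reflexive (begin
  zval k (b1 ∷ []) + F (1 + k) ≡⟨ cong (_+ F (1 + k)) (zval-b1 k) ⟩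
  F (3 + k)                    ≡⟨ cong (λ i → F (2 + i)) (+-comm 1 k) ⟩
  F (2 + (k + 1))              ∎)
  where open ≡-Reasoning
zval-bound k (b1 ∷ b0 ∷ es) p = begin
  (1 * F (2 + k) + z) + F (1 + k) ≡⟨ cong (λ a → a + z + F (1 + k)) (*-identityˡ _) ⟩
  (F (2 + k) + z) + F (1 + k)     ≡⟨ cong (_+ F (1 + k)) (+-comm (F (2 + k)) z) ⟩
  (z + F (2 + k)) + F (1 + k)     ≡⟨ +-assoc z _ _ ⟩
  z + F (3 + k)                   ≤⟨ zval-bound (2 + k) es p ⟩
  F (2 + (2 + k + length es))     ≡⟨ cong (λ i → F (2 + i)) (sym (trans (+-suc k _) (cong suc (+-suc k _)))) ⟩
  F (2 + (k + length (b1 ∷ b0 ∷ es))) ∎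
  where
  open ≤-Reasoning
  z = zval (2 + k) es

zval<F : ∀ k ds → NoAdj ds → zval k ds < F (2 + (k + length ds))
zval<F k ds p = <-≤-trans (m<m+n _ (F-pos k)) (zval-bound k ds p)

F≤zval-∷ʳ-b1 : ∀ k xs → F (2 + (k + length xs)) ≤ zval k (xs ∷ʳ b1)
F≤zval-∷ʳ-b1 k xs = begin
  F (2 + (k + length xs))                 ≤⟨ m≤n+m _ (zval k xs) ⟩
  zval k xs + F (2 + (k + length xs))     ≡⟨ cong (zval k xs +_) (sym (*-identityˡ _)) ⟩
  zval k xs + 1 * F (2 + (k + length xs)) ≡⟨ sym (zval-∷ʳ k xs b1) ⟩
  zval k (xs ∷ʳ b1)                       ∎
  where open ≤-Reasoning

zval<zval-∷ʳ-b1 : ∀ k xs ys → NoAdj xs → length xs ≤ length ys → zval k xs < zval k (ys ∷ʳ b1)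
zval<zval-∷ʳ-b1 k xs ys p le = begin-strict
  zval k xs               <⟨ zval<F k xs p ⟩
  F (2 + (k + length xs)) ≤⟨ F-monotone (s≤s (s≤s (+-monoʳ-≤ k le))) ⟩
  F (2 + (k + length ys)) ≤⟨ F≤zval-∷ʳ-b1 k ys ⟩
  zval k (ys ∷ʳ b1)       ∎
  where open ≤-Reasoning

length-∷ʳ : ∀ (xs : List Bit) x → length (xs ∷ʳ x) ≡ suc (length xs)
length-∷ʳ xs x = trans (length-++ xs) (+-comm (length xs) 1)

-- Induction on the most significant digit: trailing zeros are dropped, and the
-- positions of the leading ones must agree by zval<zval-∷ʳ-b1.
digitSum-unique : ∀ {k ds es} → Reverse ds → Reverse es → NoAdj ds → NoAdj es →
  zval k ds ≡ zval k es → digitSum ds ≡ digitSum es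
digitSum-unique [] [] _ _ _ = refl
digitSum-unique {k} (xs ∶ rxs ∶ʳ b0) res p q e =
  trans (trans (digitSum-∷ʳ xs b0) (+-identityʳ _))
    (digitSum-unique rxs res (NoAdj-++⁻ˡ xs _ p) q
      (trans (sym (trans (zval-∷ʳ k xs b0) (+-identityʳ _))) e))
digitSum-unique {k} rds (ys ∶ rys ∶ʳ b0) p q e =
  trans (digitSum-unique rds rys p (NoAdj-++⁻ˡ ys _ q)
          (trans e (trans (zval-∷ʳ k ys b0) (+-identityʳ _))))
    (sym (trans (digitSum-∷ʳ ys b0) (+-identityʳ _)))
digitSum-unique {k} [] (ys ∶ _ ∶ʳ b1) _ _ e =
  ⊥-elim (<⇒≢ (zval<zval-∷ʳ-b1 k [] ys tt z≤n) e)
digitSum-unique {k} (xs ∶ _ ∶ʳ b1) [] _ _ e =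
  ⊥-elim (<⇒≢ (zval<zval-∷ʳ-b1 k [] xs tt z≤n) (sym e))
digitSum-unique {k} (xs ∶ rxs ∶ʳ b1) (ys ∶ rys ∶ʳ b1) p q e
  with <-cmp (length xs) (length ys)
... | tri< xs<ys _ _ =
  ⊥-elim (<⇒≢ (zval<zval-∷ʳ-b1 k (xs ∷ʳ b1) ys p (≤-trans (≤-reflexive (length-∷ʳ xs b1)) xs<ys)) e)
... | tri> _ _ ys<xs =
  ⊥-elim (<⇒≢ (zval<zval-∷ʳ-b1 k (ys ∷ʳ b1) xs q (≤-trans (≤-reflexive (length-∷ʳ ys b1)) ys<xs)) (sym e))
... | tri≈ _ |xs|≡|ys| _ = begin
  digitSum (xs ∷ʳ b1) ≡⟨ digitSum-∷ʳ xs b1 ⟩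
  digitSum xs + 1     ≡⟨ cong (_+ 1) (digitSum-unique rxs rys (NoAdj-++⁻ˡ xs _ p) (NoAdj-++⁻ˡ ys _ q) zval≡) ⟩
  digitSum ys + 1     ≡⟨ sym (digitSum-∷ʳ ys b1) ⟩
  digitSum (ys ∷ʳ b1) ∎
  where
  open ≡-Reasoning
  top : List Bit → ℕ
  top zs = 1 * F (2 + (k + length zs))
  zval≡ : zval k xs ≡ zval k ys
  zval≡ = +-cancelʳ-≡ (top xs) (zval k xs) (zval k ys) (begin
    zval k xs + top xs ≡⟨ sym (zval-∷ʳ k xs b1) ⟩
    zval k (xs ∷ʳ b1)  ≡⟨ e ⟩
    zval k (ys ∷ʳ b1)  ≡⟨ zval-∷ʳ k ys b1 ⟩
    zval k ys + top ys ≡⟨ cong (λ i → zval k ys + 1 * F (2 + (k + i))) (sym |xs|≡|ys|) ⟩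
    zval k ys + top xs ∎)

IsZeck-digitSum-unique : ∀ {n} ds es → IsZeck n ds → IsZeck n es → digitSum ds ≡ digitSum es
IsZeck-digitSum-unique ds es (zds , pds) (zes , pes) =
  digitSum-unique (reverseView ds) (reverseView es) pds pes (trans zds (sym zes))

IsZeck-++ : ∀ {m n} ds ys → length ds ≡ m → IsZeck n ds → NoAdj (ds ++ ys) →
  IsZeck (n + zval m ys) (ds ++ ys)
IsZeck-++ ds ys refl (zds , _) p = trans (zval-++ 0 ds ys) (cong (_+ zval (length ds) ys) zds) , p

ZeckOfLength : ℕ → ℕ → Set
ZeckOfLength m n = ∃[ ds ] length ds ≡ m × IsZeck n ds

ZeckOfLength-∷ʳ-b0 : ∀ {m n} → ZeckOfLength m n → ZeckOfLength (suc m) n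
ZeckOfLength-∷ʳ-b0 {m} {n} (ds , |ds| , zds) =
  ds ∷ʳ b0 ,
  trans (length-∷ʳ ds b0) (cong suc |ds|) ,
  subst (λ v → IsZeck v (ds ∷ʳ b0)) (+-identityʳ n)
    (IsZeck-++ ds (b0 ∷ []) |ds| zds (NoAdj-++-b0 ds [] (proj₂ zds) tt))

ZeckOfLength-++-b0b1 : ∀ {m n} → ZeckOfLength m n → ZeckOfLength (2 + m) (n + F (3 + m))
ZeckOfLength-++-b0b1 {m} {n} (ds , |ds| , zds) =
  ds ++ b0 ∷ b1 ∷ [] ,
  trans (length-++ ds) (trans (cong (_+ 2) |ds|) (+-comm m 2)) ,
  subst (λ v → IsZeck (n + v) (ds ++ b0 ∷ b1 ∷ [])) (zval-b1 (suc m))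
    (IsZeck-++ ds (b0 ∷ b1 ∷ []) |ds| zds (NoAdj-++-b0 ds _ (proj₂ zds) tt))

-- The greedy step: either n < F (3 + m) already fits in m + 1 digits,
-- or n − F (3 + m) < F (2 + m) fits in m digits and gets the block 0 1 on top.
ZeckOfLength-step : ∀ m n → n < F (4 + m) →
  (∀ k → k < F (3 + m) → ZeckOfLength (suc m) k) →
  (∀ k → k < F (2 + m) → ZeckOfLength m k) →
  ZeckOfLength (2 + m) n
ZeckOfLength-step m n n<F below-F[3+m] below-F[2+m] with n <? F (3 + m)
... | yes n<F′ = ZeckOfLength-∷ʳ-b0 (below-F[3+m] n n<F′)
... | no n≮F′ =
  subst (ZeckOfLength (2 + m)) (m∸n+n≡m F≤n)
    (ZeckOfLength-++-b0b1 (below-F[2+m] (n ∸ F (3 + m)) n∸F<F))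
  where
  F≤n : F (3 + m) ≤ n
  F≤n = ≮⇒≥ n≮F′
  n∸F<F : n ∸ F (3 + m) < F (2 + m)
  n∸F<F = +-cancelˡ-< (F (3 + m)) _ _ (subst (_< F (4 + m)) (sym (m+[n∸m]≡n F≤n)) n<F)

Zeck-exists : ∀ m n → n < F (2 + m) → ZeckOfLength m n
Zeck-exists zero zero _ = [] , refl , refl , tt
Zeck-exists zero (suc n) (s≤s ())
Zeck-exists (suc zero) zero _ = b0 ∷ [] , refl , refl , tt
Zeck-exists (suc zero) (suc zero) _ = b1 ∷ [] , refl , refl , tt
Zeck-exists (suc zero) (suc (suc n)) (s≤s (s≤s ()))
Zeck-exists (suc (suc m)) n n<F = ZeckOfLength-step m n n<F (Zeck-exists (suc m)) (Zeck-exists m)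

-- A number below F (2 + m) occupies digits 0 … m − 1 only, so adding the value
-- of a high block ys placed from digit m + 1 on just concatenates digit strings.
digitSum-cong-high-digits : ∀ {m n ys ys′} ds es → n < F (2 + m) → NoAdj ys → NoAdj ys′ →
  digitSum ys ≡ digitSum ys′ →
  IsZeck (n + zval (suc m) ys) ds → IsZeck (n + zval (suc m) ys′) es →
  digitSum ds ≡ digitSum es
digitSum-cong-high-digits {m} {n} {ys} {ys′} ds es n<F p p′ ys≡ys′ zds zes
  with Zeck-exists m n n<F
... | low , |low| , zlow = begin
  digitSum ds                  ≡⟨ IsZeck-digitSum-unique ds (low ++ b0 ∷ ys) zds (with-high ys p) ⟩
  digitSum (low ++ b0 ∷ ys)    ≡⟨ digitSum-++ low _ ⟩
  digitSum low + digitSum ys   ≡⟨ cong (digitSum low +_) ys≡ys′ ⟩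
  digitSum low + digitSum ys′  ≡⟨ sym (digitSum-++ low _) ⟩
  digitSum (low ++ b0 ∷ ys′)   ≡⟨ IsZeck-digitSum-unique (low ++ b0 ∷ ys′) es (with-high ys′ p′) zes ⟩
  digitSum es                  ∎
  where
  open ≡-Reasoning
  with-high : ∀ zs → NoAdj zs → IsZeck (n + zval (suc m) zs) (low ++ b0 ∷ zs)
  with-high zs q = IsZeck-++ low (b0 ∷ zs) |low| zlow (NoAdj-++-b0 low zs (proj₂ zlow) q)

IsZeck-zval⇒digitSum≡ : ∀ m ys ds → NoAdj ys → IsZeck (zval m ys) ds → digitSum ds ≡ digitSum ys
IsZeck-zval⇒digitSum≡ m ys ds p zds =
  trans (IsZeck-digitSum-unique ds (replicate m b0 ++ ys) zds
          (zval-replicate-b0-++ 0 m ys , NoAdj-replicate-b0-++ m ys p))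
        (digitSum-replicate-b0-++ m ys)

F+1≡F-suc : ∀ ℓ → F (ℓ + 1) ≡ F (suc ℓ)
F+1≡F-suc ℓ = cong F (+-comm ℓ 1)

F+2≡F-suc-suc : ∀ ℓ → F (ℓ + 2) ≡ F (2 + ℓ)
F+2≡F-suc-suc ℓ = cong F (+-comm ℓ 2)

digitSum-shift-invariant : ∀ m n → n < F (2 + m) → (ds es : List Bit) →
  IsZeck (n + F (2 + m + 1)) ds → IsZeck (n + F (2 + m + 2)) es → digitSum ds ≡ digitSum es
digitSum-shift-invariant m n n<F ds es zds zes =
  digitSum-cong-high-digits {m} {n} {b1 ∷ []} {b0 ∷ b1 ∷ []} ds es n<F tt tt refl
    (subst (λ v → IsZeck (n + v) ds) (trans (F+1≡F-suc (2 + m)) (sym (zval-b1 (suc m)))) zds)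
    (subst (λ v → IsZeck (n + v) es) (trans (F+2≡F-suc-suc (2 + m)) (sym (zval-b1 (2 + m)))) zes)

digitSum-parity-differs : ∀ m (ds es : List Bit) →
  IsZeck (F (2 + m) + F (2 + m + 1)) ds → IsZeck (F (2 + m) + F (2 + m + 2)) es →
  digitSum ds % 2 ≢ digitSum es % 2
digitSum-parity-differs m ds es zds zes = 1%2≢2%2 ∘ subst₂ (λ a b → a % 2 ≡ b % 2) sZ≡1 sZ≡2
  where
  1%2≢2%2 : 1 % 2 ≢ 2 % 2
  1%2≢2%2 ()
  Fℓ+F[ℓ+1] : F (2 + m) + F (2 + m + 1) ≡ zval m (b0 ∷ b0 ∷ b1 ∷ [])
  Fℓ+F[ℓ+1] = begin
    F (2 + m) + F (2 + m + 1) ≡⟨ cong (F (2 + m) +_) (F+1≡F-suc (2 + m)) ⟩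
    F (2 + m) + F (3 + m)     ≡⟨ +-comm (F (2 + m)) _ ⟩
    F (4 + m)                 ≡⟨ sym (zval-b1 (2 + m)) ⟩
    zval m (b0 ∷ b0 ∷ b1 ∷ []) ∎
    where open ≡-Reasoning
  Fℓ+F[ℓ+2] : F (2 + m) + F (2 + m + 2) ≡ zval m (b1 ∷ b0 ∷ b1 ∷ [])
  Fℓ+F[ℓ+2] = cong₂ _+_ (sym (*-identityˡ (F (2 + m)))) (trans (F+2≡F-suc-suc (2 + m)) (sym (zval-b1 (2 + m))))
  sZ≡1 : digitSum ds ≡ 1
  sZ≡1 = IsZeck-zval⇒digitSum≡ m (b0 ∷ b0 ∷ b1 ∷ []) ds tt (subst (λ v → IsZeck v ds) Fℓ+F[ℓ+1] zds)
  sZ≡2 : digitSum es ≡ 2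
  sZ≡2 = IsZeck-zval⇒digitSum≡ m (b1 ∷ b0 ∷ b1 ∷ []) es tt (subst (λ v → IsZeck v es) Fℓ+F[ℓ+2] zes)

lemma2p2 : (ℓ : ℕ) → 2 ≤ ℓ →
    ((n : ℕ) → n < F ℓ →
      (ds es : List Bit) → IsZeck (n + F (ℓ + 1)) ds → IsZeck (n + F (ℓ + 2)) es →
      digitSum ds ≡ digitSum es)
    × ((ds es : List Bit) → IsZeck (F ℓ + F (ℓ + 1)) ds → IsZeck (F ℓ + F (ℓ + 2)) es →
      digitSum ds % 2 ≢ digitSum es % 2)
lemma2p2 (suc (suc m)) (s≤s (s≤s z≤n)) = digitSum-shift-invariant m , digitSum-parity-differs m
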